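{- If $C \overset{\omega}{\twoheadrightarrow} C'$ then there exists a finite configuration $x$ of the unitary event structure $[\![C]\!]$ with a covering chain $\emptyset\subset x_1\subset\cdots\subset x_n=x$ whose sequence of added events (read through their labels, with event $\tau_b^n$ read as $P_b^n$) is $\omega$.
   Context: Quantum commands over $N$ qubits: $C ::= \mathtt{skip} \mid U(\vec n) \mid C;C \mid \mathtt{meas}\ n\ C_1\ C_2 \mid C\parallel C$, where $U(\vec n)$ applies unitary $U$ to qubits $\vec n$, $\mathtt{meas}\ n\ C_1\ C_2$ measures qubit $n$ and continues with $C_1$ after projection $P_0^n$ and with $C_2$ after $P_1^n$, and $C_1\parallel C_2$ requires disjoint qubit sets. Labels: $sk$, $U(\vec n)$, $P_0^n$, $P_1^n$. Small steps: $\mathtt{skip}\xrightarrow{sk}\checkmark$, $U(\vec n)\xrightarrow{U(\vec n)}\checkmark$, $\mathtt{meas}\ n\ C_1\ C_2\xrightarrow{P_0^n}C_1$ and $\xrightarrow{P_1^n}C_2$; sequential and parallel composition as usual (left component of $;$ moves, reaching $\checkmark$ leaves $C_2$; either side of $\parallel$ moves, a finished side is dropped). Multi-step: $C\overset{l}{\twoheadrightarrow}C'$ if $C\xrightarrow{l}C'$; $C\overset{l:\omega'}{\twoheadrightarrow}C'$ if $C\xrightarrow{l}C''\overset{\omega'}{\twoheadrightarrow}C'$. A unitary event structure is an event structure $(E,\le,\#)$ (partial order with finite down-closures, hereditary conflict; configurations are conflict-free down-closed sets) with a map $Q$ from events to unitary or projection operators such that concurrent events have commuting operators, minimal conflict is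 transitive, and the sum of $Q$ over each minimal-conflict class is unitary. Interpretation $[\![C]\!]$: $[\![\mathtt{skip}]\!]$ is one event $sk$ with $Q=Id$; $[\![U(\vec n)]\!]$ is one event with $Q=U(\vec n)$; $[\![C_1;C_2]\!]$ has events $E_1\uplus(E_2\times$ maximal configurations of $[\![C_1]\!])$, with $e_1\le(e_2,x)$ for $e_1\in x$ and $Q$ inherited; $[\![\mathtt{meas}\ n\ C_1\ C_2]\!]$ has new events $\tau_0^n,\tau_1^n$ (with $Q=P_0^n,P_1^n$) in conflict, $\tau_0^n$ below all events of $[\![C_1]\!]$ and $\tau_1^n$ below all of $[\![C_2]\!]$, everything on the $\tau_0^n$ side in conflict with everything on the $\tau_1^n$ side; $[\![C_1\parallel C_2]\!]$ is the disjoint union. A covering chain of $x$ is a chain $\emptyset\subset x_1\subset\cdots\subset x_n=x$ of configurations each adding one event. -}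

module Defs where

open import Data.Nat using (ℕ; zero; suc; _+_; _*_)
open import Data.Bool using (Bool; true; false; _∧_; _∨_; not; T)
open import Data.Fin using (Fin; zero; suc; splitAt; remQuot; _≟_)
open import Data.Fin.Subset using (Subset; ⁅_⁆; _∪_; _∈_; _∉_) renaming (⊥ to ∅)
open import Data.Vec using (Vec; []; _∷_; lookup; fromList)
open import Data.List using (List; []; _∷_; _++_; map; filter; length)
open import Data.List.Membership.Propositional using () renaming (_∈_ to _∈ₗ_)
open import Data.Sum using (_⊎_; inj₁; inj₂)
open import Data.Product using (_×_; _,_; proj₁; proj₂)
open import Data.Empty using (⊥)
open import Data.Unit using (⊤)
open import Relation.Nullary using (¬_; does)
open import Relation.Nullary.Decidable using (⌊_⌋)
open import Relation.Unary using (Decidable)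

-- Syntax.  G is an (abstract) set of names of unitary gates; N the
-- number of qubits.

data Cmd (G : Set) (N : ℕ) : Set where
  skip : Cmd G N
  U⟨_,_⟩ : G → List (Fin N) → Cmd G N
  _⨾_ : Cmd G N → Cmd G N → Cmd G N
  meas : Fin N → Cmd G N → Cmd G N → Cmd G N
  _∥_ : Cmd G N → Cmd G N → Cmd G N

-- Labels: sk, U(\vec n), P_b^n  (b = false means 0, b = true means 1)
data Label (G : Set) (N : ℕ) : Set where
  sk : Label G N
  U : G → List (Fin N) → Label G N
  P : Bool → Fin N → Label G N

qubits : ∀ {G N} → Cmd G N → List (Fin N)
qubits skip = []
qubits U⟨ g , ns ⟩ = ns
qubits (C₁ ⨾ C₂) = qubits C₁ ++ qubits C₂
qubits (meas n C₁ C₂) = n ∷ (qubits C₁ ++ qubits C₂)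
qubits (C₁ ∥ C₂) = qubits C₁ ++ qubits C₂

WF : ∀ {G N} → Cmd G N → Set
WF skip = ⊤
WF U⟨ g , ns ⟩ = ⊤
WF (C₁ ⨾ C₂) = WF C₁ × WF C₂
WF (meas n C₁ C₂) = WF C₁ × WF C₂
WF (C₁ ∥ C₂) = WF C₁ × WF C₂ × (∀ q → q ∈ₗ qubits C₁ → q ∈ₗ qubits C₂ → ⊥)

data Res (G : Set) (N : ℕ) : Set where
  ✓ : Res G N
  ⟨_⟩ : Cmd G N → Res G N

data _—[_]→_ {G : Set} {N : ℕ} : Cmd G N → Label G N → Res G N → Set where
  skip→ : skip —[ sk ]→ ✓
  U→ : ∀ {g ns} → U⟨ g , ns ⟩ —[ U g ns ]→ ✓
  meas₀ : ∀ {n C₁ C₂} → meas n C₁ C₂ —[ P false n ]→ ⟨ C₁ ⟩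
  meas₁ : ∀ {n C₁ C₂} → meas n C₁ C₂ —[ P true n ]→ ⟨ C₂ ⟩
  seq✓ : ∀ {C₁ C₂ l} → C₁ —[ l ]→ ✓ → (C₁ ⨾ C₂) —[ l ]→ ⟨ C₂ ⟩
  seq→ : ∀ {C₁ C₁' C₂ l} → C₁ —[ l ]→ ⟨ C₁' ⟩ → (C₁ ⨾ C₂) —[ l ]→ ⟨ C₁' ⨾ C₂ ⟩
  parˡ✓ : ∀ {C₁ C₂ l} → C₁ —[ l ]→ ✓ → (C₁ ∥ C₂) —[ l ]→ ⟨ C₂ ⟩
  parˡ→ : ∀ {C₁ C₁' C₂ l} → C₁ —[ l ]→ ⟨ C₁' ⟩ → (C₁ ∥ C₂) —[ l ]→ ⟨ C₁' ∥ C₂ ⟩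
  parʳ✓ : ∀ {C₁ C₂ l} → C₂ —[ l ]→ ✓ → (C₁ ∥ C₂) —[ l ]→ ⟨ C₁ ⟩
  parʳ→ : ∀ {C₁ C₂ C₂' l} → C₂ —[ l ]→ ⟨ C₂' ⟩ → (C₁ ∥ C₂) —[ l ]→ ⟨ C₁ ∥ C₂' ⟩

data _↠[_]_ {G : Set} {N : ℕ} : Cmd G N → List (Label G N) → Res G N → Set where
  one : ∀ {C l C'} → C —[ l ]→ C' → C ↠[ l ∷ [] ] C'
  more : ∀ {C l C'' ω C'} → C —[ l ]→ ⟨ C'' ⟩ → C'' ↠[ ω ] C' → C ↠[ l ∷ ω ] C'

-- The operator Q of an event is
-- represented symbolically by its label (Id for sk, U(\vec n), P_b^n).

record ES (G : Set) (N : ℕ) : Set where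
  field
    size : ℕ
    leq : Fin size → Fin size → Bool
    cf : Fin size → Fin size → Bool
    lab : Fin size → Label G N

allF : ∀ n → (Fin n → Bool) → Bool
allF zero p = true
allF (suc n) p = p zero ∧ allF n (λ i → p (suc i))

anyF : ∀ n → (Fin n → Bool) → Bool
anyF zero p = false
anyF (suc n) p = p zero ∨ anyF n (λ i → p (suc i))

subsets : ∀ n → List (Subset n)
subsets zero = [] ∷ []
subsets (suc n) = map (true ∷_) (subsets n) ++ map (false ∷_) (subsets n)

allL : ∀ {A : Set} → (A → Bool) → List A → Bool
allL p [] = true
allL p (x ∷ xs) = p x ∧ allL p xs

_⇒ᵇ_ : Bool → Bool → Bool
a ⇒ᵇ b = not a ∨ b

module _ {G : Set} {N : ℕ} (S : ES G N) where
  open ES S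

  isConfig : Subset size → Bool
  isConfig x = allF size λ e → allF size λ e' →
    ((lookup x e ∧ leq e' e) ⇒ᵇ lookup x e') ∧
    ((lookup x e ∧ lookup x e') ⇒ᵇ not (cf e e'))

  _⊆ᵇ_ : Subset size → Subset size → Bool
  x ⊆ᵇ y = allF size λ e → lookup x e ⇒ᵇ lookup y e

  isMaxConfig : Subset size → Bool
  isMaxConfig x = isConfig x ∧
    allL (λ y → (isConfig y ∧ (x ⊆ᵇ y)) ⇒ᵇ (y ⊆ᵇ x)) (subsets size)

  maxConfigs : List (Subset size)
  maxConfigs = filter (λ x → T? (isMaxConfig x)) (subsets size)
    where
    T? : (b : Bool) → Relation.Nullary.Dec (T b)
    T? = Data.Bool.T?

  IsConfig : Subset size → Set
  IsConfig x = T (isConfig x)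

  CoveringChainFrom : Subset size → List (Fin size) → Set
  CoveringChainFrom s [] = ⊤
  CoveringChainFrom s (e ∷ es) =
    e ∉ s × IsConfig (s ∪ ⁅ e ⁆) × CoveringChainFrom (s ∪ ⁅ e ⁆) es

  chainEnd : Subset size → List (Fin size) → Subset size
  chainEnd s [] = s
  chainEnd s (e ∷ es) = chainEnd (s ∪ ⁅ e ⁆) es

⟦_⟧ : ∀ {G N} → Cmd G N → ES G N
⟦ skip ⟧ = record { size = 1 ; leq = λ _ _ → true ; cf = λ _ _ → false ; lab = λ _ → sk }
⟦ U⟨ g , ns ⟩ ⟧ = record { size = 1 ; leq = λ _ _ → true ; cf = λ _ _ → false ; lab = λ _ → U g ns }
⟦ C₁ ⨾ C₂ ⟧ = record { size = n₁ + n₂ * m ; leq = le ; cf = c ; lab = lb }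
  where
  S₁ = ⟦ C₁ ⟧
  S₂ = ⟦ C₂ ⟧
  n₁ = ES.size S₁
  n₂ = ES.size S₂
  M : Vec (Subset n₁) (length (maxConfigs S₁))
  M = fromList (maxConfigs S₁)
  m = length (maxConfigs S₁)
  -- events: E₁ ⊎ (E₂ × maximal configurations of [[C₁]])
  ev : Fin (n₁ + n₂ * m) → Fin n₁ ⊎ (Fin n₂ × Fin m)
  ev i with splitAt n₁ i
  ... | inj₁ a = inj₁ a
  ... | inj₂ j = inj₂ (remQuot m j)
  le' : Fin n₁ ⊎ (Fin n₂ × Fin m) → Fin n₁ ⊎ (Fin n₂ × Fin m) → Bool
  le' (inj₁ a) (inj₁ b) = ES.leq S₁ a b
  le' (inj₁ a) (inj₂ (e , x)) = lookup (lookup M x) a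
  le' (inj₂ _) (inj₁ _) = false
  le' (inj₂ (e , x)) (inj₂ (e' , x')) = ⌊ x ≟ x' ⌋ ∧ ES.leq S₂ e e'
  -- conflict: inherited, plus the hereditary closure of conflict through
  -- the maximal configuration tags
  cfx : Fin n₁ → Fin m → Bool
  cfx a x = anyF n₁ λ b → lookup (lookup M x) b ∧ ES.cf S₁ a b
  c' : Fin n₁ ⊎ (Fin n₂ × Fin m) → Fin n₁ ⊎ (Fin n₂ × Fin m) → Bool
  c' (inj₁ a) (inj₁ b) = ES.cf S₁ a b
  c' (inj₁ a) (inj₂ (e , x)) = cfx a x
  c' (inj₂ (e , x)) (inj₁ a) = cfx a x
  c' (inj₂ (e , x)) (inj₂ (e' , x')) =
    (anyF n₁ λ a → lookup (lookup M x) a ∧ cfx a x') ∨ ES.cf S₂ e e'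
  lb' : Fin n₁ ⊎ (Fin n₂ × Fin m) → Label _ _
  lb' (inj₁ a) = ES.lab S₁ a
  lb' (inj₂ (e , x)) = ES.lab S₂ e
  le = λ i j → le' (ev i) (ev j)
  c = λ i j → c' (ev i) (ev j)
  lb = λ i → lb' (ev i)
⟦ meas n C₁ C₂ ⟧ = record { size = 2 + (n₁ + n₂) ; leq = le ; cf = c ; lab = lb }
  where
  S₁ = ⟦ C₁ ⟧
  S₂ = ⟦ C₂ ⟧
  n₁ = ES.size S₁
  n₂ = ES.size S₂
  data V : Set where
    τ : Bool → V
    L : Fin n₁ → V
    R : Fin n₂ → V
  ev : Fin (2 + (n₁ + n₂)) → V
  ev zero = τ false
  ev (suc zero) = τ true
  ev (suc (suc i)) with splitAt n₁ i
  ... | inj₁ a = L a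
  ... | inj₂ b = R b
  side : V → Bool
  side (τ b) = b
  side (L _) = false
  side (R _) = true
  le' : V → V → Bool
  le' (τ b) (τ b') = ⌊ Data.Bool._≟_ b b' ⌋
  le' (τ false) (L _) = true
  le' (τ true) (R _) = true
  le' (L a) (L a') = ES.leq S₁ a a'
  le' (R a) (R a') = ES.leq S₂ a a'
  le' _ _ = false
  c' : V → V → Bool
  c' (L a) (L a') = ES.cf S₁ a a'
  c' (R a) (R a') = ES.cf S₂ a a'
  c' v w = not ⌊ Data.Bool._≟_ (side v) (side w) ⌋
  lb' : V → Label _ _
  lb' (τ b) = P b n
  lb' (L a) = ES.lab S₁ a
  lb' (R a) = ES.lab S₂ a
  le = λ i j → le' (ev i) (ev j)
  c = λ i j → c' (ev i) (ev j)
  lb = λ i → lb' (ev i)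
⟦ C₁ ∥ C₂ ⟧ = record { size = n₁ + n₂ ; leq = le ; cf = c ; lab = lb }
  where
  S₁ = ⟦ C₁ ⟧
  S₂ = ⟦ C₂ ⟧
  n₁ = ES.size S₁
  n₂ = ES.size S₂
  le : Fin (n₁ + n₂) → Fin (n₁ + n₂) → Bool
  le i j with splitAt n₁ i | splitAt n₁ j
  ... | inj₁ a | inj₁ b = ES.leq S₁ a b
  ... | inj₂ a | inj₂ b = ES.leq S₂ a b
  ... | _ | _ = false
  c : Fin (n₁ + n₂) → Fin (n₁ + n₂) → Bool
  c i j with splitAt n₁ i | splitAt n₁ j
  ... | inj₁ a | inj₁ b = ES.cf S₁ a b
  ... | inj₂ a | inj₂ b = ES.cf S₂ a b
  ... | _ | _ = false
  lb : Fin (n₁ + n₂) → Label _ _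
  lb i with splitAt n₁ i
  ... | inj₁ a = ES.lab S₁ a
  ... | inj₂ b = ES.lab S₂ b

module Submission where

-- A run of C is realised, by induction on C, as a covering chain of ⟦C⟧ from ∅ with the same
-- labels, which ends in a maximal configuration when the run terminates. Each construction of ⟦_⟧
-- embeds the structures of its components so that covering steps are preserved: a parallel run
-- interleaves chains of the two sides, and a measurement prefixes the chain of the chosen branch
-- with τ_b. Maximality is what makes sequential composition work: when C₁ terminates its chain ends
-- in a maximal configuration x of ⟦C₁⟧, and the run of C₂ continues in the copy of ⟦C₂⟧ tagged by x.

open import Defs
open import Data.Bool using (Bool; true; false; _∧_; _∨_; not; T; if_then_else_)
open import Data.Bool.Properties using (T-∧; T-∨; T-≡; T?)
open import Data.Empty using (⊥-elim)
open import Data.Fin using (Fin; zero; suc; _↑ˡ_; _↑ʳ_; combine; quotRem; _≟_)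
open import Data.Fin.Properties using (combine-remQuot; remQuot-combine; splitAt-↑ˡ; splitAt-↑ʳ)
open import Data.Fin.Subset using (Subset; ⁅_⁆; _∪_; _∈_; _∉_; _⊆_) renaming (⊥ to ∅)
open import Data.Fin.Subset.Properties using (x∈⁅x⁆; x∈⁅y⁆⇒x≡y; ∉⊥; ⊆-antisym; ∪-identityˡ; ∪-identityʳ; ∪-idem)
open import Data.List using (List; []; _∷_; map)
import Data.List as List
import Data.List.Relation.Unary.Any as Any
import Data.List.Relation.Unary.All as All
open import Data.List.Relation.Unary.AllPairs using ([]; _∷_)
open import Data.List.Relation.Unary.Unique.Propositional using (Unique)
open import Data.List.Relation.Ternary.Interleaving.Propositional using (Interleaving; []; consˡ; consʳ)
open import Data.List.Relation.Unary.Any.Properties using (lookup-index)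
import Data.List.Relation.Unary.Unique.Propositional.Properties as Unique
open import Data.List.Membership.Propositional.Properties
  using (∈-++⁺ˡ; ∈-++⁺ʳ; ∈-map⁺; ∈-map⁻; ∈-lookup; ∈-filter⁺; ∈-filter⁻)
open import Data.List.Membership.Propositional using () renaming (_∈_ to _∈ₗ_)
open import Data.Nat using (ℕ; zero; suc; _+_; _*_)
open import Data.Product using (Σ; ∃; _×_; _,_; proj₁; proj₂; swap)
open import Data.Sum using (inj₁; inj₂)
open import Data.Unit using (tt)
open import Data.Vec using ([]; _∷_; lookup; _++_; tabulate; here; there)
import Data.Vec as Vec
open import Data.Vec.Properties
  using ([]=⇒lookup; lookup⇒[]=; lookup-++ˡ; lookup-++ʳ; lookup∘tabulate; zipWith-++; ∷-injectiveʳ)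
open import Function using (_⇔_; mk⇔; Equivalence)
open import Relation.Binary.PropositionalEquality
open import Relation.Nullary using (¬_)
open import Relation.Nullary.Decidable using (⌊_⌋; toWitness; fromWitness)

open Equivalence using (to; from)

T-⇒ᵇ : ∀ a b → T (a ⇒ᵇ b) ⇔ (T a → T b)
T-⇒ᵇ true  b = mk⇔ (λ t _ → t) (λ f → f tt)
T-⇒ᵇ false b = mk⇔ (λ _ ()) (λ _ → tt)

T-not : ∀ a → T (not a) ⇔ (¬ T a)
T-not true  = mk⇔ (λ ()) (λ f → f tt)
T-not false = mk⇔ (λ _ ()) (λ _ → tt)

T-allF : ∀ n (p : Fin n → Bool) → T (allF n p) ⇔ (∀ i → T (p i))
T-allF zero    p = mk⇔ (λ _ ()) (λ _ → tt)
T-allF (suc n) p = mk⇔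
  (λ t → λ { zero → proj₁ (to T-∧ t) ; (suc i) → to (T-allF n _) (proj₂ (to (T-∧ {p zero}) t)) i })
  (λ f → from T-∧ (f zero , from (T-allF n _) (λ i → f (suc i))))

T-anyF⇒ : ∀ n (p : Fin n → Bool) → T (anyF n p) → ∃ λ i → T (p i)
T-anyF⇒ (suc n) p t with to (T-∨ {p zero}) t
... | inj₁ t₀ = zero , t₀
... | inj₂ t₁ = let i , tᵢ = T-anyF⇒ n _ t₁ in suc i , tᵢ

T-allL : ∀ {A : Set} (p : A → Bool) xs → T (allL p xs) ⇔ (∀ {y} → y ∈ₗ xs → T (p y))
T-allL p []       = mk⇔ (λ _ ()) (λ _ → tt)
T-allL p (x ∷ xs) = mk⇔
  (λ t → λ { (Any.here refl) → proj₁ (to T-∧ t)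
            ; (Any.there y∈)  → to (T-allL p xs) (proj₂ (to (T-∧ {p x}) t)) y∈ })
  (λ f → from T-∧ (f (Any.here refl) , from (T-allL p xs) (λ y∈ → f (Any.there y∈))))

T-lookup⇔∈ : ∀ {n} (x : Subset n) i → T (lookup x i) ⇔ (i ∈ x)
T-lookup⇔∈ x i = mk⇔ (λ t → lookup⇒[]= i x (to (T-≡ {lookup x i}) t)) (λ i∈x → subst T (sym ([]=⇒lookup i∈x)) tt)

module _ {m n : ℕ} {x : Subset m} {y : Subset n} where

  ↑ˡ∈-++⁺ : ∀ {a} → a ∈ x → a ↑ˡ n ∈ x ++ y
  ↑ˡ∈-++⁺ {a} a∈x = lookup⇒[]= (a ↑ˡ n) (x ++ y) (trans (lookup-++ˡ x y a) ([]=⇒lookup a∈x))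

  ↑ˡ∈-++⁻ : ∀ {a} → a ↑ˡ n ∈ x ++ y → a ∈ x
  ↑ˡ∈-++⁻ {a} a∈ = lookup⇒[]= a x (trans (sym (lookup-++ˡ x y a)) ([]=⇒lookup a∈))

  ↑ʳ∈-++⁺ : ∀ {b} → b ∈ y → m ↑ʳ b ∈ x ++ y
  ↑ʳ∈-++⁺ {b} b∈y = lookup⇒[]= (m ↑ʳ b) (x ++ y) (trans (lookup-++ʳ x y b) ([]=⇒lookup b∈y))

  ↑ʳ∈-++⁻ : ∀ {b} → m ↑ʳ b ∈ x ++ y → b ∈ y
  ↑ʳ∈-++⁻ {b} b∈ = lookup⇒[]= b y (trans (sym (lookup-++ʳ x y b)) ([]=⇒lookup b∈))

∅++∅ : ∀ m {n} → ∅ {m} ++ ∅ {n} ≡ ∅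
∅++∅ zero    = refl
∅++∅ (suc m) = cong (false ∷_) (∅++∅ m)

∪-++ : ∀ {m n} (x x′ : Subset m) (y y′ : Subset n) → (x ++ y) ∪ (x′ ++ y′) ≡ (x ∪ x′) ++ (y ∪ y′)
∪-++ x x′ y y′ = zipWith-++ _∨_ x y x′ y′

⁅↑ˡ⁆ : ∀ {m} n (a : Fin m) → ⁅ a ↑ˡ n ⁆ ≡ ⁅ a ⁆ ++ ∅ {n}
⁅↑ˡ⁆ {suc m} n zero    = cong (true ∷_) (sym (∅++∅ m))
⁅↑ˡ⁆         n (suc a) = cong (false ∷_) (⁅↑ˡ⁆ n a)

⁅↑ʳ⁆ : ∀ m {n} (b : Fin n) → ⁅ m ↑ʳ b ⁆ ≡ ∅ {m} ++ ⁅ b ⁆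
⁅↑ʳ⁆ zero    b = refl
⁅↑ʳ⁆ (suc m) b = cong (false ∷_) (⁅↑ʳ⁆ m b)

++-∪-⁅↑ˡ⁆ : ∀ {m n} (x : Subset m) (y : Subset n) a → (x ++ y) ∪ ⁅ a ↑ˡ n ⁆ ≡ (x ∪ ⁅ a ⁆) ++ y
++-∪-⁅↑ˡ⁆ {n = n} x y a = begin
  (x ++ y) ∪ ⁅ a ↑ˡ n ⁆   ≡⟨ cong ((x ++ y) ∪_) (⁅↑ˡ⁆ n a) ⟩
  (x ++ y) ∪ (⁅ a ⁆ ++ ∅) ≡⟨ ∪-++ x ⁅ a ⁆ y ∅ ⟩
  (x ∪ ⁅ a ⁆) ++ (y ∪ ∅)  ≡⟨ cong ((x ∪ ⁅ a ⁆) ++_) (∪-identityʳ y) ⟩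
  (x ∪ ⁅ a ⁆) ++ y        ∎
  where open ≡-Reasoning

++-∪-⁅↑ʳ⁆ : ∀ {m n} (x : Subset m) (y : Subset n) b → (x ++ y) ∪ ⁅ m ↑ʳ b ⁆ ≡ x ++ (y ∪ ⁅ b ⁆)
++-∪-⁅↑ʳ⁆ {m} x y b = begin
  (x ++ y) ∪ ⁅ m ↑ʳ b ⁆   ≡⟨ cong ((x ++ y) ∪_) (⁅↑ʳ⁆ m b) ⟩
  (x ++ y) ∪ (∅ ++ ⁅ b ⁆) ≡⟨ ∪-++ x ∅ y ⁅ b ⁆ ⟩
  (x ∪ ∅) ++ (y ∪ ⁅ b ⁆)  ≡⟨ cong (_++ (y ∪ ⁅ b ⁆)) (∪-identityʳ x) ⟩
  x ++ (y ∪ ⁅ b ⁆)        ∎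
  where open ≡-Reasoning

_⊗_ : ∀ {m n} → Subset m → Subset n → Subset (m * n)
[]      ⊗ q = []
(b ∷ p) ⊗ q = (if b then q else ∅) ++ p ⊗ q

∅-⊗ : ∀ m {n} (q : Subset n) → ∅ {m} ⊗ q ≡ ∅
∅-⊗ zero    q = refl
∅-⊗ (suc m) {n} q = trans (cong (∅ ++_) (∅-⊗ m q)) (∅++∅ n)

∪-⊗ : ∀ {m n} (p p′ : Subset m) (q : Subset n) → (p ∪ p′) ⊗ q ≡ p ⊗ q ∪ p′ ⊗ q
∪-⊗ []      []        q = refl
∪-⊗ (b ∷ p) (b′ ∷ p′) q =
  trans (cong₂ _++_ (if-∨ b b′) (∪-⊗ p p′ q)) (sym (∪-++ _ _ (p ⊗ q) (p′ ⊗ q)))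
  where
  if-∨ : ∀ b b′ → (if b ∨ b′ then q else ∅) ≡ (if b then q else ∅) ∪ (if b′ then q else ∅)
  if-∨ true  true  = sym (∪-idem q)
  if-∨ true  false = sym (∪-identityʳ q)
  if-∨ false _     = sym (∪-identityˡ _)

⁅⁆-⊗-⁅⁆ : ∀ {m n} (a : Fin m) (j : Fin n) → ⁅ a ⁆ ⊗ ⁅ j ⁆ ≡ ⁅ combine a j ⁆
⁅⁆-⊗-⁅⁆ {suc m} {n} zero    j = trans (cong (⁅ j ⁆ ++_) (∅-⊗ m ⁅ j ⁆)) (sym (⁅↑ˡ⁆ (m * n) j))
⁅⁆-⊗-⁅⁆ {suc m} {n} (suc a) j = trans (cong (∅ ++_) (⁅⁆-⊗-⁅⁆ a j)) (sym (⁅↑ʳ⁆ n (combine a j)))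

combine∈-⊗⁺ : ∀ {m n} {p : Subset m} {q : Subset n} {a j} → a ∈ p → j ∈ q → combine a j ∈ p ⊗ q
combine∈-⊗⁺ here        j∈q = ↑ˡ∈-++⁺ j∈q
combine∈-⊗⁺ (there a∈p) j∈q = ↑ʳ∈-++⁺ (combine∈-⊗⁺ a∈p j∈q)

combine∈-⊗⁻ : ∀ {m n} (p : Subset m) {q : Subset n} a {j} → combine a j ∈ p ⊗ q → a ∈ p × j ∈ q
combine∈-⊗⁻ (true  ∷ p) zero    c∈ = here , ↑ˡ∈-++⁻ c∈
combine∈-⊗⁻ (false ∷ p) zero    c∈ = ⊥-elim (∉⊥ (↑ˡ∈-++⁻ c∈))
combine∈-⊗⁻ (b     ∷ p) (suc a) c∈ = let a∈p , j∈q = combine∈-⊗⁻ p a (↑ʳ∈-++⁻ c∈) in there a∈p , j∈q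

preimage : ∀ {m n} → (Fin m → Fin n) → Subset n → Subset m
preimage ι z = tabulate (λ a → lookup z (ι a))

∈-preimage⁻ : ∀ {m n} {ι : Fin m → Fin n} {z a} → a ∈ preimage ι z → ι a ∈ z
∈-preimage⁻ {ι = ι} {z} {a} a∈ = lookup⇒[]= (ι a) z (trans (sym (lookup∘tabulate _ a)) ([]=⇒lookup a∈))

∈-preimage⁺ : ∀ {m n} {ι : Fin m → Fin n} {z a} → ι a ∈ z → a ∈ preimage ι z
∈-preimage⁺ {ι = ι} {z} {a} ιa∈ = lookup⇒[]= a (preimage ι z) (trans (lookup∘tabulate _ a) ([]=⇒lookup ιa∈))

data Split (m n : ℕ) : Fin (m + n) → Set where
  inˡ : (a : Fin m) → Split m n (a ↑ˡ n)
  inʳ : (b : Fin n) → Split m n (m ↑ʳ b)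

split : ∀ m n i → Split m n i
split zero    n i       = inʳ i
split (suc m) n zero    = inˡ zero
split (suc m) n (suc i) with split m n i
... | inˡ a = inˡ (suc a)
... | inʳ b = inʳ b

data Combined (m n : ℕ) : Fin (m * n) → Set where
  combined : (a : Fin m) (j : Fin n) → Combined m n (combine a j)

-- ⟦C₁ ⨾ C₂⟧ decodes events with remQuot = swap ∘ quotRem, which only rewrites in this form
quotRem-combine : ∀ {m n} (a : Fin m) (j : Fin n) → quotRem n (combine a j) ≡ (j , a)
quotRem-combine a j = cong swap (remQuot-combine a j)

uncombine : ∀ m n k → Combined m n k
uncombine m n k = subst (Combined m n) (combine-remQuot {m} n k) (combined _ _)

-- Configurations

lookup-fromList : ∀ {A : Set} (xs : List A) i → lookup (Vec.fromList xs) i ≡ List.lookup xs i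
lookup-fromList (x ∷ xs) zero    = refl
lookup-fromList (x ∷ xs) (suc i) = lookup-fromList xs i

Unique-lookup-injective : ∀ {A : Set} {xs : List A} → Unique xs →
                          ∀ i j → List.lookup xs i ≡ List.lookup xs j → i ≡ j
Unique-lookup-injective (x∉xs ∷ u) zero    zero    _  = refl
Unique-lookup-injective (x∉xs ∷ u) zero    (suc j) eq = ⊥-elim (All.lookup x∉xs (∈-lookup j) eq)
Unique-lookup-injective (x∉xs ∷ u) (suc i) zero    eq = ⊥-elim (All.lookup x∉xs (∈-lookup i) (sym eq))
Unique-lookup-injective (x∉xs ∷ u) (suc i) (suc j) eq = cong suc (Unique-lookup-injective u i j eq)

∈-subsets : ∀ n (y : Subset n) → y ∈ₗ subsets n
∈-subsets zero    []          = Any.here refl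
∈-subsets (suc n) (true  ∷ y) = ∈-++⁺ˡ (∈-map⁺ (true ∷_) (∈-subsets n y))
∈-subsets (suc n) (false ∷ y) = ∈-++⁺ʳ (List.map (true ∷_) (subsets n)) (∈-map⁺ (false ∷_) (∈-subsets n y))

subsets-unique : ∀ n → Unique (subsets n)
subsets-unique zero    = All.[] ∷ []
subsets-unique (suc n) =
  Unique.++⁺ (Unique.map⁺ ∷-injectiveʳ (subsets-unique n)) (Unique.map⁺ ∷-injectiveʳ (subsets-unique n)) disjoint
  where
  disjoint : ∀ {v} → ¬ (v ∈ₗ List.map (true ∷_) (subsets n) × v ∈ₗ List.map (false ∷_) (subsets n))
  disjoint (v∈ , v∈′) with ∈-map⁻ (true ∷_) v∈ | ∈-map⁻ (false ∷_) v∈′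
  ... | _ , _ , refl | _ , _ , ()

config-clause : ∀ a b c d f → T (((a ∧ b) ⇒ᵇ c) ∧ ((a ∧ d) ⇒ᵇ not f)) ⇔ ((T a → T b → T c) × (T a → T d → ¬ T f))
config-clause false b c d f = mk⇔ (λ _ → (λ ()) , (λ ())) (λ _ → tt)
config-clause true  b c d f = mk⇔
  (λ t → let t₁ , t₂ = to T-∧ t in (λ _ → to (T-⇒ᵇ b c) t₁) , (λ _ tᵈ → to (T-not f) (to (T-⇒ᵇ d (not f)) t₂ tᵈ)))
  (λ (h₁ , h₂) → from T-∧ (from (T-⇒ᵇ b c) (h₁ tt) , from (T-⇒ᵇ d (not f)) (λ tᵈ → from (T-not f) (h₂ tt tᵈ))))

module _ {G : Set} {N : ℕ} (S : ES G N) where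
  open ES S

  record Configuration (x : Subset size) : Set where
    field
      down-closed   : ∀ {e e′} → e ∈ x → T (leq e′ e) → e′ ∈ x
      conflict-free : ∀ {e e′} → e ∈ x → e′ ∈ x → ¬ T (cf e e′)

  IsConfig⇔Configuration : ∀ x → IsConfig S x ⇔ Configuration x
  IsConfig⇔Configuration x = mk⇔
    (λ t → record
      { down-closed   = λ {e} {e′} e∈x e′≤e → ∈x e′ (proj₁ (clause t e e′) (∈x⁻ e∈x) e′≤e)
      ; conflict-free = λ {e} {e′} e∈x e′∈x → proj₂ (clause t e e′) (∈x⁻ e∈x) (∈x⁻ e′∈x) })
    (λ c → from (T-allF size _) λ e → from (T-allF size _) λ e′ →
      from (config-clause (lookup x e) (leq e′ e) (lookup x e′) (lookup x e′) (cf e e′))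
        ( (λ tᵉ e′≤e → ∈x⁻ (Configuration.down-closed c (∈x e tᵉ) e′≤e))
        , (λ tᵉ tᵉ′ → Configuration.conflict-free c (∈x e tᵉ) (∈x e′ tᵉ′))))
    where
    ∈x : ∀ e → T (lookup x e) → e ∈ x
    ∈x e = to (T-lookup⇔∈ x e)
    ∈x⁻ : ∀ {e} → e ∈ x → T (lookup x e)
    ∈x⁻ {e} = from (T-lookup⇔∈ x e)
    clause : IsConfig S x → ∀ e e′ → (T (lookup x e) → T (leq e′ e) → T (lookup x e′)) ×
                                      (T (lookup x e) → T (lookup x e′) → ¬ T (cf e e′))
    clause t e e′ = to (config-clause (lookup x e) (leq e′ e) (lookup x e′) (lookup x e′) (cf e e′))
                       (to (T-allF size _) (to (T-allF size _) t e) e′)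

  ∅-config : Configuration ∅
  ∅-config = record { down-closed = λ e∈∅ _ → ⊥-elim (∉⊥ e∈∅) ; conflict-free = λ e∈∅ _ _ → ∉⊥ e∈∅ }

  Maximal : Subset size → Set
  Maximal x = Configuration x × (∀ {y} → Configuration y → x ⊆ y → y ⊆ x)

  ⊆ᵇ⇒⊆ : ∀ x y → T (_⊆ᵇ_ S x y) → x ⊆ y
  ⊆ᵇ⇒⊆ x y t {e} e∈x = to (T-lookup⇔∈ y e) (to (T-⇒ᵇ _ _) (to (T-allF size _) t e) (from (T-lookup⇔∈ x e) e∈x))

  ⊆⇒⊆ᵇ : ∀ x y → x ⊆ y → T (_⊆ᵇ_ S x y)
  ⊆⇒⊆ᵇ x y x⊆y = from (T-allF size _) λ e → from (T-⇒ᵇ _ _) λ tᵉ →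
    from (T-lookup⇔∈ y e) (x⊆y (to (T-lookup⇔∈ x e) tᵉ))

  isMaxConfig⇔Maximal : ∀ x → T (isMaxConfig S x) ⇔ Maximal x
  isMaxConfig⇔Maximal x = mk⇔ max⇒ max⇐
    where
    max⇒ : T (isMaxConfig S x) → Maximal x
    max⇒ t = to (IsConfig⇔Configuration x) (proj₁ (to T-∧ t)) , λ {y} cy x⊆y →
      ⊆ᵇ⇒⊆ y x (to (T-⇒ᵇ _ _) (to (T-allL _ (subsets size)) (proj₂ (to (T-∧ {isConfig S x}) t)) (∈-subsets size y))
        (from T-∧ (from (IsConfig⇔Configuration y) cy , ⊆⇒⊆ᵇ x y x⊆y)))
    max⇐ : Maximal x → T (isMaxConfig S x)
    max⇐ (cx , max) = from T-∧ (from (IsConfig⇔Configuration x) cx ,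
      from (T-allL _ (subsets size)) λ {y} _ → from (T-⇒ᵇ _ _) λ t →
        ⊆⇒⊆ᵇ y x (max (to (IsConfig⇔Configuration y) (proj₁ (to T-∧ t)))
                      (⊆ᵇ⇒⊆ x y (proj₂ (to (T-∧ {isConfig S y}) t)))))

  maxConfig : Fin (List.length (maxConfigs S)) → Subset size
  maxConfig = lookup (Vec.fromList (maxConfigs S))

  maxConfig-maximal : ∀ i → Maximal (maxConfig i)
  maxConfig-maximal i rewrite lookup-fromList (maxConfigs S) i =
    to (isMaxConfig⇔Maximal _) (proj₂ (∈-filter⁻ (λ x → T? (isMaxConfig S x)) {xs = subsets size} (∈-lookup i)))

  maxConfig-surjective : ∀ {x} → Maximal x → ∃ λ i → maxConfig i ≡ x
  maxConfig-surjective {x} mx =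
    Any.index x∈ , trans (lookup-fromList (maxConfigs S) _) (sym (lookup-index x∈))
    where
    x∈ : x ∈ₗ maxConfigs S
    x∈ = ∈-filter⁺ (λ x → T? (isMaxConfig S x)) (∈-subsets size x) (from (isMaxConfig⇔Maximal x) mx)

  maxConfig-injective : ∀ i j → maxConfig i ≡ maxConfig j → i ≡ j
  maxConfig-injective i j eq =
    Unique-lookup-injective (Unique.filter⁺ (λ x → T? (isMaxConfig S x)) (subsets-unique size)) i j
      (trans (sym (lookup-fromList (maxConfigs S) i)) (trans eq (lookup-fromList (maxConfigs S) j)))

-- Covering chains

module _ {G : Set} {N : ℕ} (S : ES G N) where
  open ES S

  data Chain : Subset size → List (Label G N) → Subset size → Set where
    []   : ∀ {s} → Chain s [] s
    step : ∀ {s e ω t} → e ∉ s → IsConfig S (s ∪ ⁅ e ⁆) → Chain (s ∪ ⁅ e ⁆) ω t → Chain s (lab e ∷ ω) t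

module _ {G : Set} {N : ℕ} {S : ES G N} where
  open ES S

  step-≡ : ∀ {s s′ e l ω t} → e ∉ s → IsConfig S s′ → s ∪ ⁅ e ⁆ ≡ s′ → lab e ≡ l →
           Chain S s′ ω t → Chain S s (l ∷ ω) t
  step-≡ e∉s c′ refl refl ch = step e∉s c′ ch

  _++ᶜ_ : ∀ {s ω t ω′ u} → Chain S s ω t → Chain S t ω′ u → Chain S s (ω List.++ ω′) u
  []               ++ᶜ ch′ = ch′
  step e∉s c ch    ++ᶜ ch′ = step e∉s c (ch ++ᶜ ch′)

  Chain-IsConfig : ∀ {s ω t} → IsConfig S s → Chain S s ω t → IsConfig S t
  Chain-IsConfig c []              = c
  Chain-IsConfig _ (step _ c′ ch)  = Chain-IsConfig c′ ch

  Chain⇒CoveringChain : ∀ {s ω t} → Chain S s ω t →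
    Σ (List (Fin size)) λ es → CoveringChainFrom S s es × chainEnd S s es ≡ t × map lab es ≡ ω
  Chain⇒CoveringChain []                    = [] , tt , refl , refl
  Chain⇒CoveringChain (step {e = e} e∉s c ch) =
    let es , cover , end , labels = Chain⇒CoveringChain ch in
    e ∷ es , (e∉s , c , cover) , end , cong (lab e ∷_) labels

-- image s is the direct image of s under ι together with a fixed context of the target
-- (τ_b for a measurement, the state of the other component for parallel and sequential composition)
record Embedding {G : Set} {N : ℕ} (S S′ : ES G N) : Set where
  open ES
  field
    ι              : Fin (size S) → Fin (size S′)
    ι-leq          : ∀ {a b} → T (leq S a b) → T (leq S′ (ι a) (ι b))
    ι-cf           : ∀ {a b} → T (cf S a b) → T (cf S′ (ι a) (ι b))
    lab-ι          : ∀ a → lab S′ (ι a) ≡ lab S a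
    image          : Subset (size S) → Subset (size S′)
    image-∪⁅⁆      : ∀ s a → image (s ∪ ⁅ a ⁆) ≡ image s ∪ ⁅ ι a ⁆
    image-reflects : ∀ {s a} → ι a ∈ image s → a ∈ s
    image-config   : ∀ {s} → Configuration S s → Configuration S′ (image s)

  image-step : ∀ {s a ω t} → a ∉ s → IsConfig S (s ∪ ⁅ a ⁆) → Chain S′ (image (s ∪ ⁅ a ⁆)) ω t →
               Chain S′ (image s) (lab S a ∷ ω) t
  image-step {s} {a} a∉s c ch =
    step-≡ (λ ιa∈ → a∉s (image-reflects ιa∈))
      (from (IsConfig⇔Configuration S′ _) (image-config (to (IsConfig⇔Configuration S _) c)))
      (sym (image-∪⁅⁆ s a)) (lab-ι a) ch

  image-chain : ∀ {s ω t} → Chain S s ω t → Chain S′ (image s) ω (image t)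
  image-chain []              = []
  image-chain (step a∉s c ch) = image-step a∉s c (image-chain ch)

  preimage-config : ∀ {z} → Configuration S′ z → Configuration S (preimage ι z)
  preimage-config cz = record
    { down-closed   = λ a∈ b≤a → ∈-preimage⁺ (down-closed cz (∈-preimage⁻ a∈) (ι-leq b≤a))
    ; conflict-free = λ a∈ b∈ a#b → conflict-free cz (∈-preimage⁻ a∈) (∈-preimage⁻ b∈) (ι-cf a#b) }
    where open Configuration

record Realisation {G : Set} {N : ℕ} (C : Cmd G N) (ω : List (Label G N)) (R : Res G N) : Set where
  field
    final         : Subset (ES.size ⟦ C ⟧)
    chain         : Chain ⟦ C ⟧ ∅ ω final
    final-maximal : R ≡ ✓ → Maximal ⟦ C ⟧ final

module Parallel {G : Set} {N : ℕ} (C₁ C₂ : Cmd G N) where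
  private
    S₁ S₂ S : ES G N
    S₁ = ⟦ C₁ ⟧
    S₂ = ⟦ C₂ ⟧
    S  = ⟦ C₁ ∥ C₂ ⟧
    n₁ n₂ : ℕ
    n₁ = ES.size S₁
    n₂ = ES.size S₂
  open ES

  leq-ˡˡ : ∀ a b → leq S (a ↑ˡ n₂) (b ↑ˡ n₂) ≡ leq S₁ a b
  leq-ˡˡ a b rewrite splitAt-↑ˡ n₁ a n₂ | splitAt-↑ˡ n₁ b n₂ = refl

  leq-ˡʳ : ∀ a b → leq S (a ↑ˡ n₂) (n₁ ↑ʳ b) ≡ false
  leq-ˡʳ a b rewrite splitAt-↑ˡ n₁ a n₂ | splitAt-↑ʳ n₁ n₂ b = refl

  leq-ʳˡ : ∀ a b → leq S (n₁ ↑ʳ a) (b ↑ˡ n₂) ≡ false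
  leq-ʳˡ a b rewrite splitAt-↑ʳ n₁ n₂ a | splitAt-↑ˡ n₁ b n₂ = refl

  leq-ʳʳ : ∀ a b → leq S (n₁ ↑ʳ a) (n₁ ↑ʳ b) ≡ leq S₂ a b
  leq-ʳʳ a b rewrite splitAt-↑ʳ n₁ n₂ a | splitAt-↑ʳ n₁ n₂ b = refl

  cf-ˡˡ : ∀ a b → cf S (a ↑ˡ n₂) (b ↑ˡ n₂) ≡ cf S₁ a b
  cf-ˡˡ a b rewrite splitAt-↑ˡ n₁ a n₂ | splitAt-↑ˡ n₁ b n₂ = refl

  cf-ˡʳ : ∀ a b → cf S (a ↑ˡ n₂) (n₁ ↑ʳ b) ≡ false
  cf-ˡʳ a b rewrite splitAt-↑ˡ n₁ a n₂ | splitAt-↑ʳ n₁ n₂ b = refl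

  cf-ʳˡ : ∀ a b → cf S (n₁ ↑ʳ a) (b ↑ˡ n₂) ≡ false
  cf-ʳˡ a b rewrite splitAt-↑ʳ n₁ n₂ a | splitAt-↑ˡ n₁ b n₂ = refl

  cf-ʳʳ : ∀ a b → cf S (n₁ ↑ʳ a) (n₁ ↑ʳ b) ≡ cf S₂ a b
  cf-ʳʳ a b rewrite splitAt-↑ʳ n₁ n₂ a | splitAt-↑ʳ n₁ n₂ b = refl

  lab-ˡ : ∀ a → lab S (a ↑ˡ n₂) ≡ lab S₁ a
  lab-ˡ a rewrite splitAt-↑ˡ n₁ a n₂ = refl

  lab-ʳ : ∀ b → lab S (n₁ ↑ʳ b) ≡ lab S₂ b
  lab-ʳ b rewrite splitAt-↑ʳ n₁ n₂ b = refl

  ++-config : ∀ {x y} → Configuration S₁ x → Configuration S₂ y → Configuration S (x ++ y)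
  ++-config {x} {y} cx cy = record { down-closed = closed ; conflict-free = free }
    where
    open Configuration
    closed : ∀ {e e′} → e ∈ x ++ y → T (leq S e′ e) → e′ ∈ x ++ y
    closed {e} {e′} e∈ e′≤e with split n₁ n₂ e | split n₁ n₂ e′
    ... | inˡ a | inˡ b = ↑ˡ∈-++⁺ (down-closed cx (↑ˡ∈-++⁻ e∈) (subst T (leq-ˡˡ b a) e′≤e))
    ... | inˡ a | inʳ b = ⊥-elim (subst T (leq-ʳˡ b a) e′≤e)
    ... | inʳ a | inˡ b = ⊥-elim (subst T (leq-ˡʳ b a) e′≤e)
    ... | inʳ a | inʳ b = ↑ʳ∈-++⁺ (down-closed cy (↑ʳ∈-++⁻ e∈) (subst T (leq-ʳʳ b a) e′≤e))
    free : ∀ {e e′} → e ∈ x ++ y → e′ ∈ x ++ y → ¬ T (cf S e e′)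
    free {e} {e′} e∈ e′∈ e#e′ with split n₁ n₂ e | split n₁ n₂ e′
    ... | inˡ a | inˡ b = conflict-free cx (↑ˡ∈-++⁻ e∈) (↑ˡ∈-++⁻ e′∈) (subst T (cf-ˡˡ a b) e#e′)
    ... | inˡ a | inʳ b = subst T (cf-ˡʳ a b) e#e′
    ... | inʳ a | inˡ b = subst T (cf-ʳˡ a b) e#e′
    ... | inʳ a | inʳ b = conflict-free cy (↑ʳ∈-++⁻ e∈) (↑ʳ∈-++⁻ e′∈) (subst T (cf-ʳʳ a b) e#e′)

  inj-left : ∀ {y} → Configuration S₂ y → Embedding S₁ S
  inj-left {y} cy = record
    { ι              = _↑ˡ n₂
    ; ι-leq          = λ {a} {b} → subst T (sym (leq-ˡˡ a b))
    ; ι-cf           = λ {a} {b} → subst T (sym (cf-ˡˡ a b))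
    ; lab-ι          = lab-ˡ
    ; image          = _++ y
    ; image-∪⁅⁆      = λ s a → sym (++-∪-⁅↑ˡ⁆ s y a)
    ; image-reflects = ↑ˡ∈-++⁻
    ; image-config   = λ cs → ++-config cs cy
    }

  inj-right : ∀ {x} → Configuration S₁ x → Embedding S₂ S
  inj-right {x} cx = record
    { ι              = n₁ ↑ʳ_
    ; ι-leq          = λ {a} {b} → subst T (sym (leq-ʳʳ a b))
    ; ι-cf           = λ {a} {b} → subst T (sym (cf-ʳʳ a b))
    ; lab-ι          = lab-ʳ
    ; image          = x ++_
    ; image-∪⁅⁆      = λ s b → sym (++-∪-⁅↑ʳ⁆ x s b)
    ; image-reflects = ↑ʳ∈-++⁻
    ; image-config   = ++-config cx
    }

  ++-maximal : ∀ {x y} → Maximal S₁ x → Maximal S₂ y → Maximal S (x ++ y)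
  ++-maximal {x} {y} (cx , x-max) (cy , y-max) = ++-config cx cy , above⊆
    where
    above⊆ : ∀ {z} → Configuration S z → x ++ y ⊆ z → z ⊆ x ++ y
    above⊆ {z} cz x++y⊆z {e} e∈z with split n₁ n₂ e
    ... | inˡ a = ↑ˡ∈-++⁺ (x-max (Embedding.preimage-config (inj-left cy) cz)
                                 (λ a∈x → ∈-preimage⁺ (x++y⊆z (↑ˡ∈-++⁺ a∈x))) (∈-preimage⁺ e∈z))
    ... | inʳ b = ↑ʳ∈-++⁺ (y-max (Embedding.preimage-config (inj-right cx) cz)
                                 (λ b∈y → ∈-preimage⁺ (x++y⊆z (↑ʳ∈-++⁺ b∈y))) (∈-preimage⁺ e∈z))

  interleave : ∀ {ω₁ ω₂ ω s₁ s₂ t₁ t₂} → Interleaving ω₁ ω₂ ω →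
    Configuration S₁ s₁ → Configuration S₂ s₂ → Chain S₁ s₁ ω₁ t₁ → Chain S₂ s₂ ω₂ t₂ →
    Chain S (s₁ ++ s₂) ω (t₁ ++ t₂)
  interleave []          _  _  []  [] = []
  interleave (consˡ ω∣ω) c₁ c₂ (step a∉ c ch₁) ch₂ =
    Embedding.image-step (inj-left c₂) a∉ c (interleave ω∣ω (to (IsConfig⇔Configuration S₁ _) c) c₂ ch₁ ch₂)
  interleave (consʳ ω∣ω) c₁ c₂ ch₁ (step b∉ c ch₂) =
    Embedding.image-step (inj-right c₁) b∉ c (interleave ω∣ω c₁ (to (IsConfig⇔Configuration S₂ _) c) ch₁ ch₂)

  realisation : ∀ {ω₁ ω₂ ω R₁ R₂ R} → Interleaving ω₁ ω₂ ω → (R ≡ ✓ → R₁ ≡ ✓ × R₂ ≡ ✓) →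
                Realisation C₁ ω₁ R₁ → Realisation C₂ ω₂ R₂ → Realisation (C₁ ∥ C₂) ω R
  realisation {ω = ω} ω₁∣ω₂ both-done P₁ P₂ = record
    { final         = final P₁ ++ final P₂
    ; chain         = subst (λ s → Chain S s ω (final P₁ ++ final P₂)) (∅++∅ n₁)
                        (interleave ω₁∣ω₂ (∅-config S₁) (∅-config S₂) (chain P₁) (chain P₂))
    ; final-maximal = λ done → ++-maximal (final-maximal P₁ (proj₁ (both-done done)))
                                          (final-maximal P₂ (proj₂ (both-done done)))
    }
    where open Realisation

module Measurement {G : Set} {N : ℕ} (q : Fin N) (C₁ C₂ : Cmd G N) where
  private
    S₁ S₂ M : ES G N
    S₁ = ⟦ C₁ ⟧
    S₂ = ⟦ C₂ ⟧
    M  = ⟦ meas q C₁ C₂ ⟧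
    n₁ n₂ : ℕ
    n₁ = ES.size S₁
    n₂ = ES.size S₂
  open ES

  τ₀ τ₁ : Fin (2 + (n₁ + n₂))
  τ₀ = zero
  τ₁ = suc zero

  L : Fin n₁ → Fin (2 + (n₁ + n₂))
  L a = suc (suc (a ↑ˡ n₂))

  R : Fin n₂ → Fin (2 + (n₁ + n₂))
  R b = suc (suc (n₁ ↑ʳ b))

  data View : Fin (2 + (n₁ + n₂)) → Set where
    τ₀-view : View τ₀
    τ₁-view : View τ₁
    L-view  : ∀ a → View (L a)
    R-view  : ∀ b → View (R b)

  view : ∀ i → View i
  view zero          = τ₀-view
  view (suc zero)    = τ₁-view
  view (suc (suc i)) with split n₁ n₂ i
  ... | inˡ a = L-view a
  ... | inʳ b = R-view b

  leq-LL : ∀ a b → leq M (L a) (L b) ≡ leq S₁ a b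
  leq-LL a b rewrite splitAt-↑ˡ n₁ a n₂ | splitAt-↑ˡ n₁ b n₂ = refl

  leq-RR : ∀ a b → leq M (R a) (R b) ≡ leq S₂ a b
  leq-RR a b rewrite splitAt-↑ʳ n₁ n₂ a | splitAt-↑ʳ n₁ n₂ b = refl

  leq-LR : ∀ a b → leq M (L a) (R b) ≡ false
  leq-LR a b rewrite splitAt-↑ˡ n₁ a n₂ | splitAt-↑ʳ n₁ n₂ b = refl

  leq-RL : ∀ a b → leq M (R b) (L a) ≡ false
  leq-RL a b rewrite splitAt-↑ˡ n₁ a n₂ | splitAt-↑ʳ n₁ n₂ b = refl

  leq-Lτ₀ : ∀ a → leq M (L a) τ₀ ≡ false
  leq-Lτ₀ a rewrite splitAt-↑ˡ n₁ a n₂ = refl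

  leq-Lτ₁ : ∀ a → leq M (L a) τ₁ ≡ false
  leq-Lτ₁ a rewrite splitAt-↑ˡ n₁ a n₂ = refl

  leq-Rτ₀ : ∀ b → leq M (R b) τ₀ ≡ false
  leq-Rτ₀ b rewrite splitAt-↑ʳ n₁ n₂ b = refl

  leq-Rτ₁ : ∀ b → leq M (R b) τ₁ ≡ false
  leq-Rτ₁ b rewrite splitAt-↑ʳ n₁ n₂ b = refl

  leq-τ₁L : ∀ a → leq M τ₁ (L a) ≡ false
  leq-τ₁L a rewrite splitAt-↑ˡ n₁ a n₂ = refl

  leq-τ₀R : ∀ b → leq M τ₀ (R b) ≡ false
  leq-τ₀R b rewrite splitAt-↑ʳ n₁ n₂ b = refl

  cf-LL : ∀ a b → cf M (L a) (L b) ≡ cf S₁ a b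
  cf-LL a b rewrite splitAt-↑ˡ n₁ a n₂ | splitAt-↑ˡ n₁ b n₂ = refl

  cf-RR : ∀ a b → cf M (R a) (R b) ≡ cf S₂ a b
  cf-RR a b rewrite splitAt-↑ʳ n₁ n₂ a | splitAt-↑ʳ n₁ n₂ b = refl

  cf-Lτ₀ : ∀ a → cf M (L a) τ₀ ≡ false
  cf-Lτ₀ a rewrite splitAt-↑ˡ n₁ a n₂ = refl

  cf-τ₀L : ∀ a → cf M τ₀ (L a) ≡ false
  cf-τ₀L a rewrite splitAt-↑ˡ n₁ a n₂ = refl

  cf-Rτ₁ : ∀ b → cf M (R b) τ₁ ≡ false
  cf-Rτ₁ b rewrite splitAt-↑ʳ n₁ n₂ b = refl

  cf-τ₁R : ∀ b → cf M τ₁ (R b) ≡ false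
  cf-τ₁R b rewrite splitAt-↑ʳ n₁ n₂ b = refl

  cf-τ₀R : ∀ b → cf M τ₀ (R b) ≡ true
  cf-τ₀R b rewrite splitAt-↑ʳ n₁ n₂ b = refl

  cf-τ₁L : ∀ a → cf M τ₁ (L a) ≡ true
  cf-τ₁L a rewrite splitAt-↑ˡ n₁ a n₂ = refl

  lab-L : ∀ a → lab M (L a) ≡ lab S₁ a
  lab-L a rewrite splitAt-↑ˡ n₁ a n₂ = refl

  lab-R : ∀ b → lab M (R b) ≡ lab S₂ b
  lab-R b rewrite splitAt-↑ʳ n₁ n₂ b = refl

  after₀ : Subset n₁ → Subset (2 + (n₁ + n₂))
  after₀ s = true ∷ false ∷ (s ++ ∅)

  after₁ : Subset n₂ → Subset (2 + (n₁ + n₂))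
  after₁ s = false ∷ true ∷ (∅ ++ s)

  L∈after₀⁺ : ∀ {s a} → a ∈ s → L a ∈ after₀ s
  L∈after₀⁺ a∈s = there (there (↑ˡ∈-++⁺ a∈s))

  L∈after₀⁻ : ∀ {s a} → L a ∈ after₀ s → a ∈ s
  L∈after₀⁻ (there (there a∈)) = ↑ˡ∈-++⁻ a∈

  R∉after₀ : ∀ {s b} → R b ∉ after₀ s
  R∉after₀ {s} (there (there b∈)) = ∉⊥ (↑ʳ∈-++⁻ {x = s} b∈)

  τ₁∉after₀ : ∀ {s} → τ₁ ∉ after₀ s
  τ₁∉after₀ (there ())

  R∈after₁⁺ : ∀ {s b} → b ∈ s → R b ∈ after₁ s
  R∈after₁⁺ b∈s = there (there (↑ʳ∈-++⁺ b∈s))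

  R∈after₁⁻ : ∀ {s b} → R b ∈ after₁ s → b ∈ s
  R∈after₁⁻ (there (there b∈)) = ↑ʳ∈-++⁻ b∈

  L∉after₁ : ∀ {s a} → L a ∉ after₁ s
  L∉after₁ {s} (there (there a∈)) = ∉⊥ (↑ˡ∈-++⁻ {y = s} a∈)

  τ₀∉after₁ : ∀ {s} → τ₀ ∉ after₁ s
  τ₀∉after₁ ()

  after₀-config : ∀ {s} → Configuration S₁ s → Configuration M (after₀ s)
  after₀-config {s} cs = record { down-closed = closed ; conflict-free = free }
    where
    open Configuration
    closed : ∀ {e e′} → e ∈ after₀ s → T (leq M e′ e) → e′ ∈ after₀ s
    closed {e} {e′} e∈ e′≤e with view e | view e′
    ... | _        | τ₀-view  = here
    ... | τ₀-view  | τ₁-view  = ⊥-elim e′≤e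
    ... | τ₀-view  | L-view b = ⊥-elim (subst T (leq-Lτ₀ b) e′≤e)
    ... | τ₀-view  | R-view b = ⊥-elim (subst T (leq-Rτ₀ b) e′≤e)
    ... | L-view a | τ₁-view  = ⊥-elim (subst T (leq-τ₁L a) e′≤e)
    ... | L-view a | L-view b = L∈after₀⁺ (down-closed cs (L∈after₀⁻ e∈) (subst T (leq-LL b a) e′≤e))
    ... | L-view a | R-view b = ⊥-elim (subst T (leq-RL a b) e′≤e)
    ... | τ₁-view  | _        = ⊥-elim (τ₁∉after₀ e∈)
    ... | R-view a | _        = ⊥-elim (R∉after₀ e∈)
    free : ∀ {e e′} → e ∈ after₀ s → e′ ∈ after₀ s → ¬ T (cf M e e′)
    free {e} {e′} e∈ e′∈ e#e′ with view e | view e′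
    ... | τ₀-view  | τ₀-view  = e#e′
    ... | τ₀-view  | L-view b = subst T (cf-τ₀L b) e#e′
    ... | L-view a | τ₀-view  = subst T (cf-Lτ₀ a) e#e′
    ... | L-view a | L-view b = conflict-free cs (L∈after₀⁻ e∈) (L∈after₀⁻ e′∈) (subst T (cf-LL a b) e#e′)
    ... | τ₁-view  | _        = τ₁∉after₀ e∈
    ... | _        | τ₁-view  = τ₁∉after₀ e′∈
    ... | R-view a | _        = R∉after₀ e∈
    ... | _        | R-view b = R∉after₀ e′∈

  after₁-config : ∀ {s} → Configuration S₂ s → Configuration M (after₁ s)
  after₁-config {s} cs = record { down-closed = closed ; conflict-free = free }
    where
    open Configuration
    closed : ∀ {e e′} → e ∈ after₁ s → T (leq M e′ e) → e′ ∈ after₁ s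
    closed {e} {e′} e∈ e′≤e with view e | view e′
    ... | _        | τ₁-view  = there here
    ... | τ₁-view  | τ₀-view  = ⊥-elim e′≤e
    ... | τ₁-view  | L-view a = ⊥-elim (subst T (leq-Lτ₁ a) e′≤e)
    ... | τ₁-view  | R-view a = ⊥-elim (subst T (leq-Rτ₁ a) e′≤e)
    ... | R-view b | τ₀-view  = ⊥-elim (subst T (leq-τ₀R b) e′≤e)
    ... | R-view b | R-view a = R∈after₁⁺ (down-closed cs (R∈after₁⁻ e∈) (subst T (leq-RR a b) e′≤e))
    ... | R-view b | L-view a = ⊥-elim (subst T (leq-LR a b) e′≤e)
    ... | τ₀-view  | _        = ⊥-elim (τ₀∉after₁ e∈)
    ... | L-view a | _        = ⊥-elim (L∉after₁ e∈)
    free : ∀ {e e′} → e ∈ after₁ s → e′ ∈ after₁ s → ¬ T (cf M e e′)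
    free {e} {e′} e∈ e′∈ e#e′ with view e | view e′
    ... | τ₁-view  | τ₁-view  = e#e′
    ... | τ₁-view  | R-view b = subst T (cf-τ₁R b) e#e′
    ... | R-view a | τ₁-view  = subst T (cf-Rτ₁ a) e#e′
    ... | R-view a | R-view b = conflict-free cs (R∈after₁⁻ e∈) (R∈after₁⁻ e′∈) (subst T (cf-RR a b) e#e′)
    ... | τ₀-view  | _        = τ₀∉after₁ e∈
    ... | _        | τ₀-view  = τ₀∉after₁ e′∈
    ... | L-view a | _        = L∉after₁ e∈
    ... | _        | L-view a = L∉after₁ e′∈

  branch₀ : Embedding S₁ M
  branch₀ = record
    { ι              = L
    ; ι-leq          = λ {a} {b} → subst T (sym (leq-LL a b))
    ; ι-cf           = λ {a} {b} → subst T (sym (cf-LL a b))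
    ; lab-ι          = lab-L
    ; image          = after₀
    ; image-∪⁅⁆      = λ s a → cong (λ z → true ∷ false ∷ z) (sym (++-∪-⁅↑ˡ⁆ s ∅ a))
    ; image-reflects = L∈after₀⁻
    ; image-config   = after₀-config
    }

  branch₁ : Embedding S₂ M
  branch₁ = record
    { ι              = R
    ; ι-leq          = λ {a} {b} → subst T (sym (leq-RR a b))
    ; ι-cf           = λ {a} {b} → subst T (sym (cf-RR a b))
    ; lab-ι          = lab-R
    ; image          = after₁
    ; image-∪⁅⁆      = λ s b → cong (λ z → false ∷ true ∷ z) (sym (++-∪-⁅↑ʳ⁆ ∅ s b))
    ; image-reflects = R∈after₁⁻
    ; image-config   = after₁-config
    }

  -- τ₀ conflicts with τ₁ and with all of the other branch, so a larger configuration only grows inside ⟦C₁⟧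
  after₀-maximal : ∀ {x} → Maximal S₁ x → Maximal M (after₀ x)
  after₀-maximal {x} (cx , x-max) = after₀-config cx , above⊆
    where
    above⊆ : ∀ {z} → Configuration M z → after₀ x ⊆ z → z ⊆ after₀ x
    above⊆ {z} cz after₀⊆z {e} e∈z with view e
    ... | τ₀-view  = here
    ... | τ₁-view  = ⊥-elim (Configuration.conflict-free cz (after₀⊆z here) e∈z tt)
    ... | R-view b = ⊥-elim (Configuration.conflict-free cz (after₀⊆z here) e∈z (subst T (sym (cf-τ₀R b)) tt))
    ... | L-view a = L∈after₀⁺ (x-max (Embedding.preimage-config branch₀ cz)
                                      (λ a∈x → ∈-preimage⁺ (after₀⊆z (L∈after₀⁺ a∈x))) (∈-preimage⁺ e∈z))

  after₁-maximal : ∀ {x} → Maximal S₂ x → Maximal M (after₁ x)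
  after₁-maximal {x} (cx , x-max) = after₁-config cx , above⊆
    where
    above⊆ : ∀ {z} → Configuration M z → after₁ x ⊆ z → z ⊆ after₁ x
    above⊆ {z} cz after₁⊆z {e} e∈z with view e
    ... | τ₁-view  = there here
    ... | τ₀-view  = ⊥-elim (Configuration.conflict-free cz e∈z (after₁⊆z (there here)) tt)
    ... | L-view a = ⊥-elim (Configuration.conflict-free cz (after₁⊆z (there here)) e∈z
                                                   (subst T (sym (cf-τ₁L a)) tt))
    ... | R-view b = R∈after₁⁺ (x-max (Embedding.preimage-config branch₁ cz)
                                      (λ b∈x → ∈-preimage⁺ (after₁⊆z (R∈after₁⁺ b∈x))) (∈-preimage⁺ e∈z))

  realisation₀ : ∀ {ω R} → Realisation C₁ ω R → Realisation (meas q C₁ C₂) (P false q ∷ ω) R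
  realisation₀ P₁ = record
    { final         = after₀ (final P₁)
    ; chain         = step-≡ {e = τ₀} ∉⊥ (from (IsConfig⇔Configuration M _) (after₀-config (∅-config S₁)))
                        (trans (∪-identityˡ ⁅ τ₀ ⁆) (cong (λ z → true ∷ false ∷ z) (sym (∅++∅ n₁))))
                        refl (Embedding.image-chain branch₀ (chain P₁))
    ; final-maximal = λ done → after₀-maximal (final-maximal P₁ done)
    }
    where open Realisation

  realisation₁ : ∀ {ω R} → Realisation C₂ ω R → Realisation (meas q C₁ C₂) (P true q ∷ ω) R
  realisation₁ P₂ = record
    { final         = after₁ (final P₂)
    ; chain         = step-≡ {e = τ₁} ∉⊥ (from (IsConfig⇔Configuration M _) (after₁-config (∅-config S₂)))
                        (trans (∪-identityˡ ⁅ τ₁ ⁆) (cong (λ z → false ∷ true ∷ z) (sym (∅++∅ n₁))))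
                        refl (Embedding.image-chain branch₁ (chain P₂))
    ; final-maximal = λ done → after₁-maximal (final-maximal P₂ done)
    }
    where open Realisation

module Sequential {G : Set} {N : ℕ} (C₁ C₂ : Cmd G N) where
  private
    S₁ S₂ S : ES G N
    S₁ = ⟦ C₁ ⟧
    S₂ = ⟦ C₂ ⟧
    S  = ⟦ C₁ ⨾ C₂ ⟧
    n₁ n₂ m : ℕ
    n₁ = ES.size S₁
    n₂ = ES.size S₂
    m  = List.length (maxConfigs S₁)
  open ES

  L : Fin n₁ → Fin (n₁ + n₂ * m)
  L a = a ↑ˡ (n₂ * m)

  -- the copy of event e of C₂ that follows the x-th maximal configuration of C₁
  R : Fin n₂ → Fin m → Fin (n₁ + n₂ * m)
  R e x = n₁ ↑ʳ combine e x

  data View : Fin (n₁ + n₂ * m) → Set where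
    L-view : ∀ a → View (L a)
    R-view : ∀ e x → View (R e x)

  view : ∀ i → View i
  view i with split n₁ (n₂ * m) i
  ... | inˡ a = L-view a
  ... | inʳ k with uncombine n₂ m k
  ... | combined e x = R-view e x

  conflicts-with : Fin n₁ → Fin m → Bool
  conflicts-with a x = anyF n₁ λ b → lookup (maxConfig S₁ x) b ∧ cf S₁ a b

  leq-LL : ∀ a b → leq S (L a) (L b) ≡ leq S₁ a b
  leq-LL a b rewrite splitAt-↑ˡ n₁ a (n₂ * m) | splitAt-↑ˡ n₁ b (n₂ * m) = refl

  leq-LR : ∀ a e x → leq S (L a) (R e x) ≡ lookup (maxConfig S₁ x) a
  leq-LR a e x rewrite splitAt-↑ˡ n₁ a (n₂ * m) | splitAt-↑ʳ n₁ (n₂ * m) (combine e x)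
                     | quotRem-combine e x = refl

  leq-RL : ∀ a e x → leq S (R e x) (L a) ≡ false
  leq-RL a e x rewrite splitAt-↑ˡ n₁ a (n₂ * m) | splitAt-↑ʳ n₁ (n₂ * m) (combine e x) = refl

  leq-RR : ∀ e x e′ x′ → leq S (R e x) (R e′ x′) ≡ (⌊ x ≟ x′ ⌋ ∧ leq S₂ e e′)
  leq-RR e x e′ x′ rewrite splitAt-↑ʳ n₁ (n₂ * m) (combine e x) | quotRem-combine e x
                         | splitAt-↑ʳ n₁ (n₂ * m) (combine e′ x′) | quotRem-combine e′ x′ = refl

  cf-LL : ∀ a b → cf S (L a) (L b) ≡ cf S₁ a b
  cf-LL a b rewrite splitAt-↑ˡ n₁ a (n₂ * m) | splitAt-↑ˡ n₁ b (n₂ * m) = refl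

  cf-LR : ∀ a e x → cf S (L a) (R e x) ≡ conflicts-with a x
  cf-LR a e x rewrite splitAt-↑ˡ n₁ a (n₂ * m) | splitAt-↑ʳ n₁ (n₂ * m) (combine e x)
                    | quotRem-combine e x = refl

  cf-RL : ∀ a e x → cf S (R e x) (L a) ≡ conflicts-with a x
  cf-RL a e x rewrite splitAt-↑ˡ n₁ a (n₂ * m) | splitAt-↑ʳ n₁ (n₂ * m) (combine e x)
                    | quotRem-combine e x = refl

  cf-RR : ∀ e x e′ x′ → cf S (R e x) (R e′ x′) ≡
          ((anyF n₁ λ a → lookup (maxConfig S₁ x) a ∧ conflicts-with a x′) ∨ cf S₂ e e′)
  cf-RR e x e′ x′ rewrite splitAt-↑ʳ n₁ (n₂ * m) (combine e x) | quotRem-combine e x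
                        | splitAt-↑ʳ n₁ (n₂ * m) (combine e′ x′) | quotRem-combine e′ x′ = refl

  lab-L : ∀ a → lab S (L a) ≡ lab S₁ a
  lab-L a rewrite splitAt-↑ˡ n₁ a (n₂ * m) = refl

  lab-R : ∀ e x → lab S (R e x) ≡ lab S₂ e
  lab-R e x rewrite splitAt-↑ʳ n₁ (n₂ * m) (combine e x) | quotRem-combine e x = refl

  before : Subset n₁ → Subset (n₁ + n₂ * m)
  before s = s ++ ∅

  R∉before : ∀ {s e x} → R e x ∉ before s
  R∉before {s} R∈ = ∉⊥ (↑ʳ∈-++⁻ {x = s} R∈)

  before-config : ∀ {s} → Configuration S₁ s → Configuration S (before s)
  before-config {s} cs = record { down-closed = closed ; conflict-free = free }
    where
    open Configuration
    closed : ∀ {e e′} → e ∈ before s → T (leq S e′ e) → e′ ∈ before s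
    closed {e} {e′} e∈ e′≤e with view e | view e′
    ... | L-view a   | L-view b   = ↑ˡ∈-++⁺ (down-closed cs (↑ˡ∈-++⁻ e∈) (subst T (leq-LL b a) e′≤e))
    ... | L-view a   | R-view e x = ⊥-elim (subst T (leq-RL a e x) e′≤e)
    ... | R-view e x | _          = ⊥-elim (R∉before e∈)
    free : ∀ {e e′} → e ∈ before s → e′ ∈ before s → ¬ T (cf S e e′)
    free {e} {e′} e∈ e′∈ e#e′ with view e | view e′
    ... | L-view a   | L-view b   = conflict-free cs (↑ˡ∈-++⁻ e∈) (↑ˡ∈-++⁻ e′∈) (subst T (cf-LL a b) e#e′)
    ... | R-view e x | _          = R∉before e∈
    ... | _          | R-view e x = R∉before e′∈

  first : Embedding S₁ S
  first = record
    { ι              = L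
    ; ι-leq          = λ {a} {b} → subst T (sym (leq-LL a b))
    ; ι-cf           = λ {a} {b} → subst T (sym (cf-LL a b))
    ; lab-ι          = lab-L
    ; image          = before
    ; image-∪⁅⁆      = λ s a → sym (++-∪-⁅↑ˡ⁆ s ∅ a)
    ; image-reflects = ↑ˡ∈-++⁻
    ; image-config   = before-config
    }

  sequence₁ : ∀ {ω t} → Chain S₁ ∅ ω t → Chain S ∅ ω (before t)
  sequence₁ {ω} {t} ch = subst (λ s → Chain S s ω (before t)) (∅++∅ n₁) (Embedding.image-chain first ch)

  module Then (i : Fin m) where
    private
      x₁ : Subset n₁
      x₁ = maxConfig S₁ i
      cx₁ : Configuration S₁ x₁
      cx₁ = proj₁ (maxConfig-maximal S₁ i)

    after : Subset n₂ → Subset (n₁ + n₂ * m)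
    after s = x₁ ++ s ⊗ ⁅ i ⁆

    L∈after⁻ : ∀ s {a} → L a ∈ after s → a ∈ x₁
    L∈after⁻ s = ↑ˡ∈-++⁻ {y = s ⊗ ⁅ i ⁆}

    R∈after⁺ : ∀ {s e} → e ∈ s → R e i ∈ after s
    R∈after⁺ e∈s = ↑ʳ∈-++⁺ (combine∈-⊗⁺ e∈s (x∈⁅x⁆ i))

    R∈after⁻ : ∀ s {e x} → R e x ∈ after s → e ∈ s × x ≡ i
    R∈after⁻ s {e} R∈ = let e∈s , x∈⁅i⁆ = combine∈-⊗⁻ s e (↑ʳ∈-++⁻ {x = x₁} R∈) in e∈s , x∈⁅y⁆⇒x≡y i x∈⁅i⁆

    no-conflict-with : ∀ {a} → a ∈ x₁ → ¬ T (conflicts-with a i)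
    no-conflict-with {a} a∈x₁ t =
      let b , tᵇ = T-anyF⇒ n₁ _ t
          b∈x₁ , a#b = to (T-∧ {lookup x₁ b}) tᵇ
      in Configuration.conflict-free cx₁ a∈x₁ (to (T-lookup⇔∈ x₁ b) b∈x₁) a#b

    after-config : ∀ {s} → Configuration S₂ s → Configuration S (after s)
    after-config {s} cs = record { down-closed = closed ; conflict-free = free }
      where
      open Configuration
      closed : ∀ {e e′} → e ∈ after s → T (leq S e′ e) → e′ ∈ after s
      closed {e} {e′} e∈ e′≤e with view e | view e′
      ... | L-view a   | L-view b     = ↑ˡ∈-++⁺ (down-closed cx₁ (L∈after⁻ s e∈) (subst T (leq-LL b a) e′≤e))
      ... | L-view a   | R-view c x   = ⊥-elim (subst T (leq-RL a c x) e′≤e)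
      ... | R-view c x | L-view b with R∈after⁻ s e∈
      ...   | _ , refl = ↑ˡ∈-++⁺ (to (T-lookup⇔∈ x₁ b) (subst T (leq-LR b c i) e′≤e))
      closed {e} {e′} e∈ e′≤e | R-view c x | R-view c′ x′ with R∈after⁻ s e∈
      ...   | c∈s , refl with to (T-∧ {⌊ x′ ≟ i ⌋}) (subst T (leq-RR c′ x′ c i) e′≤e)
      ...     | x′≡i , e′≤e₂ with toWitness x′≡i
      ...       | refl = R∈after⁺ (down-closed cs c∈s e′≤e₂)
      free : ∀ {e e′} → e ∈ after s → e′ ∈ after s → ¬ T (cf S e e′)
      free {e} {e′} e∈ e′∈ e#e′ with view e | view e′
      ... | L-view a   | L-view b   = conflict-free cx₁ (L∈after⁻ s e∈) (L∈after⁻ s e′∈) (subst T (cf-LL a b) e#e′)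
      ... | L-view a   | R-view c x with R∈after⁻ s e′∈
      ...   | _ , refl = no-conflict-with (L∈after⁻ s e∈) (subst T (cf-LR a c i) e#e′)
      free {e} {e′} e∈ e′∈ e#e′ | R-view c x | L-view a with R∈after⁻ s e∈
      ...   | _ , refl = no-conflict-with (L∈after⁻ s e′∈) (subst T (cf-RL a c i) e#e′)
      free {e} {e′} e∈ e′∈ e#e′ | R-view c x | R-view c′ x′ with R∈after⁻ s e∈ | R∈after⁻ s e′∈
      ...   | c∈s , refl | c′∈s , refl
            with to (T-∨ {anyF n₁ λ a → lookup x₁ a ∧ conflicts-with a i}) (subst T (cf-RR c i c′ i) e#e′)
      ...     | inj₂ e#e′₂ = conflict-free cs c∈s c′∈s e#e′₂
      ...     | inj₁ t     = let a , tᵃ = T-anyF⇒ n₁ _ t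
                                 a∈x₁ , a#x₁ = to (T-∧ {lookup x₁ a}) tᵃ
                             in no-conflict-with (to (T-lookup⇔∈ x₁ a) a∈x₁) a#x₁

    second : Embedding S₂ S
    second = record
      { ι              = λ c → R c i
      ; ι-leq          = λ {c} {c′} c≤c′ → subst T (sym (leq-RR c i c′ i)) (from T-∧ (fromWitness refl , c≤c′))
      ; ι-cf           = λ {c} {c′} c#c′ → subst T (sym (cf-RR c i c′ i))
                           (from (T-∨ {anyF n₁ λ a → lookup x₁ a ∧ conflicts-with a i}) (inj₂ c#c′))
      ; lab-ι          = λ c → lab-R c i
      ; image          = after
      ; image-∪⁅⁆      = after-∪⁅⁆
      ; image-reflects = λ {s} R∈ → proj₁ (R∈after⁻ s R∈)
      ; image-config   = after-config
      }
      where
      open ≡-Reasoning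
      after-∪⁅⁆ : ∀ s c → after (s ∪ ⁅ c ⁆) ≡ after s ∪ ⁅ R c i ⁆
      after-∪⁅⁆ s c = begin
        x₁ ++ (s ∪ ⁅ c ⁆) ⊗ ⁅ i ⁆           ≡⟨ cong (x₁ ++_) (∪-⊗ s ⁅ c ⁆ ⁅ i ⁆) ⟩
        x₁ ++ (s ⊗ ⁅ i ⁆ ∪ ⁅ c ⁆ ⊗ ⁅ i ⁆)   ≡⟨ cong (λ z → x₁ ++ (s ⊗ ⁅ i ⁆ ∪ z)) (⁅⁆-⊗-⁅⁆ c i) ⟩
        x₁ ++ (s ⊗ ⁅ i ⁆ ∪ ⁅ combine c i ⁆) ≡⟨ sym (++-∪-⁅↑ʳ⁆ x₁ (s ⊗ ⁅ i ⁆) (combine c i)) ⟩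
        after s ∪ ⁅ R c i ⁆                  ∎

    -- a copy of C₂ can only follow a maximal configuration that the C₁-part already contains,
    -- hence the one indexed by i
    R-index : ∀ {z c x} → Configuration S z → (∀ {a} → L a ∈ z → a ∈ x₁) → R c x ∈ z → x ≡ i
    R-index {z} {c} {x} cz L∈z⇒∈x₁ R∈z = maxConfig-injective S₁ x i (⊆-antisym maxConfig-x⊆x₁ x₁⊆maxConfig-x)
      where
      maxConfig-x⊆x₁ : maxConfig S₁ x ⊆ x₁
      maxConfig-x⊆x₁ {a} a∈ = L∈z⇒∈x₁ (Configuration.down-closed cz R∈z
                                 (subst T (sym (leq-LR a c x)) (from (T-lookup⇔∈ (maxConfig S₁ x) a) a∈)))
      x₁⊆maxConfig-x : x₁ ⊆ maxConfig S₁ x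
      x₁⊆maxConfig-x = proj₂ (maxConfig-maximal S₁ x) cx₁ maxConfig-x⊆x₁

    L∈⇒∈x₁ : ∀ {z} → Configuration S z → (∀ {a} → a ∈ x₁ → L a ∈ z) → ∀ {a} → L a ∈ z → a ∈ x₁
    L∈⇒∈x₁ cz x₁⊆z L∈z = proj₂ (maxConfig-maximal S₁ i) (Embedding.preimage-config first cz)
                            (λ a∈x₁ → ∈-preimage⁺ (x₁⊆z a∈x₁)) (∈-preimage⁺ L∈z)

    after-maximal : ∀ {y} → Maximal S₂ y → Maximal S (after y)
    after-maximal {y} (cy , y-max) = after-config cy , above⊆
      where
      above⊆ : ∀ {z} → Configuration S z → after y ⊆ z → z ⊆ after y
      above⊆ {z} cz after⊆z {e} e∈z with view e
      ... | L-view a   = ↑ˡ∈-++⁺ (L∈⇒∈x₁ cz (λ a∈x₁ → after⊆z (↑ˡ∈-++⁺ a∈x₁)) e∈z)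
      ... | R-view c x with R-index cz (L∈⇒∈x₁ cz (λ a∈x₁ → after⊆z (↑ˡ∈-++⁺ a∈x₁))) e∈z
      ...   | refl = R∈after⁺ (y-max (Embedding.preimage-config second cz)
                                     (λ c∈y → ∈-preimage⁺ (after⊆z (R∈after⁺ c∈y))) (∈-preimage⁺ e∈z))

    sequence₂ : ∀ {ω₁ ω₂ t} → Chain S₁ ∅ ω₁ x₁ → Chain S₂ ∅ ω₂ t → Chain S ∅ (ω₁ List.++ ω₂) (after t)
    sequence₂ {ω₁} {ω₂} {t} ch₁ ch₂ =
      sequence₁ ch₁ ++ᶜ subst (λ s → Chain S s ω₂ (after t)) (cong (x₁ ++_) (∅-⊗ n₂ ⁅ i ⁆))
                              (Embedding.image-chain second ch₂)

  realisation-within : ∀ {ω R₁ R} → R ≢ ✓ → Realisation C₁ ω R₁ → Realisation (C₁ ⨾ C₂) ω R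
  realisation-within not-done P₁ = record
    { final = before (final P₁) ; chain = sequence₁ (chain P₁) ; final-maximal = λ done → ⊥-elim (not-done done) }
    where open Realisation

  realisation-through : ∀ {ω₁ ω₂ R} → Realisation C₁ ω₁ ✓ → Realisation C₂ ω₂ R →
                        Realisation (C₁ ⨾ C₂) (ω₁ List.++ ω₂) R
  realisation-through P₁ P₂ with maxConfig-surjective S₁ (Realisation.final-maximal P₁ refl)
  ... | i , maxConfig-i≡final = record
    { final         = after (final P₂)
    ; chain         = sequence₂ (subst (Chain S₁ ∅ _) (sym maxConfig-i≡final) (chain P₁)) (chain P₂)
    ; final-maximal = λ done → after-maximal (final-maximal P₂ done)
    }
    where
    open Then i
    open Realisation

-- Runs

data Run {G : Set} {N : ℕ} : Res G N → List (Label G N) → Res G N → Set where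
  []  : ∀ {R} → Run R [] R
  _∷_ : ∀ {C l R ω R′} → C —[ l ]→ R → Run R ω R′ → Run ⟨ C ⟩ (l ∷ ω) R′

↠⇒Run : ∀ {G N} {C : Cmd G N} {ω R} → C ↠[ ω ] R → Run ⟨ C ⟩ ω R
↠⇒Run (one s)    = s ∷ []
↠⇒Run (more s r) = s ∷ ↠⇒Run r

interleaving-left : ∀ {A : Set} (ω : List A) → Interleaving ω [] ω
interleaving-left []      = []
interleaving-left (l ∷ ω) = consˡ (interleaving-left ω)

interleaving-right : ∀ {A : Set} (ω : List A) → Interleaving [] ω ω
interleaving-right []      = []
interleaving-right (l ∷ ω) = consʳ (interleaving-right ω)

module _ {G : Set} {N : ℕ} where

  record ParallelRun (C₁ C₂ : Cmd G N) (ω : List (Label G N)) (R : Res G N) : Set where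
    field
      {ω₁ ω₂}      : List (Label G N)
      {R₁ R₂}      : Res G N
      run₁         : Run ⟨ C₁ ⟩ ω₁ R₁
      run₂         : Run ⟨ C₂ ⟩ ω₂ R₂
      interleaving : Interleaving ω₁ ω₂ ω
      both-done    : R ≡ ✓ → R₁ ≡ ✓ × R₂ ≡ ✓

  parallel-run : ∀ {C₁ C₂ ω R} → Run ⟨ C₁ ∥ C₂ ⟩ ω R → ParallelRun C₁ C₂ ω R
  parallel-run []              = record { run₁ = [] ; run₂ = [] ; interleaving = [] ; both-done = λ () }
  parallel-run (parˡ✓ s ∷ r)   = record { run₁ = s ∷ [] ; run₂ = r ; interleaving = consˡ (interleaving-right _)
                                        ; both-done = λ done → refl , done }
  parallel-run (parʳ✓ s ∷ r)   = record { run₁ = r ; run₂ = s ∷ [] ; interleaving = consʳ (interleaving-left _)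
                                        ; both-done = λ done → done , refl }
  parallel-run (parˡ→ s ∷ r)   = let open ParallelRun (parallel-run r) in
    record { run₁ = s ∷ run₁ ; run₂ = run₂ ; interleaving = consˡ interleaving ; both-done = both-done }
  parallel-run (parʳ→ s ∷ r)   = let open ParallelRun (parallel-run r) in
    record { run₁ = run₁ ; run₂ = s ∷ run₂ ; interleaving = consʳ interleaving ; both-done = both-done }

  data SequentialRun (C₁ C₂ : Cmd G N) (ω : List (Label G N)) (R : Res G N) : Set where
    within  : ∀ {R₁} → Run ⟨ C₁ ⟩ ω R₁ → R ≢ ✓ → SequentialRun C₁ C₂ ω R
    through : ∀ {ω₁ ω₂} → Run ⟨ C₁ ⟩ ω₁ ✓ → Run ⟨ C₂ ⟩ ω₂ R → ω ≡ ω₁ List.++ ω₂ → SequentialRun C₁ C₂ ω R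

  sequential-run : ∀ {C₁ C₂ ω R} → Run ⟨ C₁ ⨾ C₂ ⟩ ω R → SequentialRun C₁ C₂ ω R
  sequential-run []           = within [] (λ ())
  sequential-run (seq✓ s ∷ r) = through (s ∷ []) r refl
  sequential-run (seq→ s ∷ r) with sequential-run r
  ... | within r₁ not-done = within (s ∷ r₁) not-done
  ... | through r₁ r₂ refl = through (s ∷ r₁) r₂ refl

  atomic : Label G N → ES G N
  atomic l = record { size = 1 ; leq = λ _ _ → true ; cf = λ _ _ → false ; lab = λ _ → l }

  atomic-chain : ∀ l → Chain (atomic l) ∅ (l ∷ []) ⁅ zero ⁆
  atomic-chain l = step {e = zero} ∉⊥ tt []

  atomic-maximal : ∀ l → Maximal (atomic l) ⁅ zero ⁆
  atomic-maximal l = to (IsConfig⇔Configuration (atomic l) ⁅ zero ⁆) tt , λ { _ _ {zero} _ → here }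

  realise : ∀ C {ω R} → Run ⟨ C ⟩ ω R → Realisation C ω R
  realise C                   []           = record { final = ∅ ; chain = [] ; final-maximal = λ () }
  realise skip                (skip→ ∷ []) =
    record { final = ⁅ zero ⁆ ; chain = atomic-chain sk ; final-maximal = λ _ → atomic-maximal sk }
  realise U⟨ g , ns ⟩         (U→ ∷ [])    =
    record { final = ⁅ zero ⁆ ; chain = atomic-chain (U g ns) ; final-maximal = λ _ → atomic-maximal (U g ns) }
  realise (meas q C₁ C₂)      (meas₀ ∷ r)  = Measurement.realisation₀ q C₁ C₂ (realise C₁ r)
  realise (meas q C₁ C₂)      (meas₁ ∷ r)  = Measurement.realisation₁ q C₁ C₂ (realise C₂ r)
  realise (C₁ ∥ C₂)           r            = let open ParallelRun (parallel-run r) in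
    Parallel.realisation C₁ C₂ interleaving both-done (realise C₁ run₁) (realise C₂ run₂)
  realise (C₁ ⨾ C₂)           r            with sequential-run r
  ... | within r₁ not-done = Sequential.realisation-within C₁ C₂ not-done (realise C₁ r₁)
  ... | through r₁ r₂ refl = Sequential.realisation-through C₁ C₂ (realise C₁ r₁) (realise C₂ r₂)

-- Well-formedness (disjoint qubits) is only needed for the operators to commute, not for the chain.
mainTheorem5 : {G : Set} {N : ℕ} (C : Cmd G N) (ω : List (Label G N)) (C' : Res G N) →
    WF C → C ↠[ ω ] C' →
    Σ (Subset (ES.size ⟦ C ⟧)) λ x → IsConfig ⟦ C ⟧ x ×
      Σ (List (Fin (ES.size ⟦ C ⟧))) λ es →
        CoveringChainFrom ⟦ C ⟧ ∅ es × chainEnd ⟦ C ⟧ ∅ es ≡ x × map (ES.lab ⟦ C ⟧) es ≡ ω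
mainTheorem5 C ω C' _ run =
  final , Chain-IsConfig (from (IsConfig⇔Configuration ⟦ C ⟧ ∅) (∅-config ⟦ C ⟧)) chain , Chain⇒CoveringChain chain
  where open Realisation (realise C (↠⇒Run run))
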